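{- Let $\Gamma$ be a bipartite distance-regular graph with vertex set $X$, diameter $D\ge4$ and valency $k\ge3$, and fix $x\in X$. Assume that for each $i$ with $2\le i\le D-2$ there exist complex scalars $\alpha_i,\beta_i$ such that for all $y,z\in X$ with $\partial(x,y)=2$, $\partial(x,z)=i$, $\partial(y,z)=i$, $$\alpha_i+\beta_i\,|\Gamma(x)\cap\Gamma(y)\cap\Gamma_{i-1}(z)|=|\Gamma_{i-1}(x)\cap\Gamma_{i-1}(y)\cap\Gamma(z)|.$$ Then for $2\le i\le D-2$, $$LR^{i-1}E_2^*=c_{i-1}\cdots c_1(c_i-\alpha_i)E_i^*A_iE_2^*-\beta_iR^{i-1}LE_2^*+c_{i-1}(b_i+\beta_ic_2)R^{i-2}E_2^*.$$
   Context: $\partial$ is path-length distance, $\Gamma_j(z)$ the set of vertices at distance $j$ from $z$, $\Gamma(z)=\Gamma_1(z)$; $c_j=|\Gamma_{j-1}(u)\cap\Gamma(w)|$, $b_j=|\Gamma_{j+1}(u)\cap\Gamma(w)|$ for $\partial(u,w)=j$. $A_j$ is the $j$-th distance matrix, $A=A_1$; $E_j^*$ the diagonal matrix in $\mathrm{Mat}_X(\mathbb{C})$ with $(z,z)$-entry $1$ if $\partial(x,z)=j$, else $0$; $L=\sum_{h=1}^DE^*_{h-1}AE^*_h$, $R=\sum_{h=0}^{D-1}E^*_{h+1}AE^*_h$. -}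

module Defs where

open import Data.Bool using (Bool; true; false; _∧_; _∨_; if_then_else_; T)
open import Data.Nat using (ℕ; zero; suc; _≤_; _≡ᵇ_)
import Data.Nat as ℕ
open import Data.Fin using (Fin; _≟_)
import Data.Fin as Fin
open import Data.Product using (Σ; _×_)
open import Relation.Nullary.Decidable using (⌊_⌋)
open import Relation.Binary.PropositionalEquality using (_≡_)
open import Algebra.Bundles using (CommutativeRing)

anyV : ∀ {n} → (Fin n → Bool) → Bool
anyV {zero}  p = false
anyV {suc n} p = p Fin.zero ∨ anyV (λ i → p (Fin.suc i))

count : ∀ {n} → (Fin n → Bool) → ℕ
count {zero}  p = 0
count {suc n} p = (if p Fin.zero then 1 else 0) ℕ.+ count (λ i → p (Fin.suc i))

record Graph (n : ℕ) : Set where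
  field
    adj       : Fin n → Fin n → Bool
    symmetric : ∀ u v → adj u v ≡ adj v u
    loopless  : ∀ u → adj u u ≡ false

-- least j ≥ start (with j < start + fuel) such that p j; else start + fuel
search : (ℕ → Bool) → ℕ → ℕ → ℕ
search p start zero       = start
search p start (suc fuel) = if p start then start else search p (suc start) fuel

module _ {n : ℕ} (Γ : Graph n) where
  open Graph Γ

  reach : ℕ → Fin n → Fin n → Bool
  reach zero    u v = ⌊ u ≟ v ⌋
  reach (suc j) u v = reach j u v ∨ anyV (λ w → adj u w ∧ reach j w v)

  -- path-length distance ∂(u,v): the least j with a walk of length ≤ j
  -- (in a connected graph on n vertices this is < n)
  dist : Fin n → Fin n → ℕ
  dist u v = search (λ j → reach j u v) 0 n

  atDist : ℕ → Fin n → Fin n → Bool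
  atDist j u v = dist u v ≡ᵇ j

  Connected : Set
  Connected = ∀ u v → Σ ℕ (λ j → T (reach j u v))

  Bipartite : Set
  Bipartite = Σ (Fin n → Bool) (λ side → ∀ u v → T (adj u v) → side u ≡ (if side v then false else true))

  HasDiameter : ℕ → Set
  HasDiameter D = Connected × (∀ u v → dist u v ≤ D) × Σ (Fin n) (λ u → Σ (Fin n) (λ v → dist u v ≡ D))

  Regular : ℕ → Set
  Regular k = ∀ u → count (λ w → adj u w) ≡ k

  -- intersection numbers: for ∂(u,w) = j,  c_j = |Γ_{j-1}(u) ∩ Γ(w)|,  b_j = |Γ_{j+1}(u) ∩ Γ(w)|
  -- (c_0 is not constrained, as Γ_{-1}(u) is empty; we use j ∸ 1 only for j ≥ 1)
  -- Γ is distance-regular with diameter D and intersection numbers c, b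
  IsDRG : ℕ → (ℕ → ℕ) → (ℕ → ℕ) → Set
  IsDRG D c b =
    HasDiameter D ×
    (∀ j u w → dist u w ≡ j → 1 ≤ j → count (λ z → atDist (j ℕ.∸ 1) u z ∧ adj w z) ≡ c j) ×
    (∀ j u w → dist u w ≡ j → count (λ z → atDist (suc j) u z ∧ adj w z) ≡ b j)

module Mat {c ℓ} (ℛ : CommutativeRing c ℓ) (n : ℕ) where
  open CommutativeRing ℛ

  M : Set c
  M = Fin n → Fin n → Carrier

  fromℕ : ℕ → Carrier
  fromℕ zero    = 0#
  fromℕ (suc m) = 1# + fromℕ m

  ∑ : ∀ {m} → (Fin m → Carrier) → Carrier
  ∑ {zero}  f = 0#
  ∑ {suc m} f = f Fin.zero + ∑ (λ i → f (Fin.suc i))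

  _⊕_ : M → M → M
  (P ⊕ Q) i j = P i j + Q i j

  _⊛_ : M → M → M
  (P ⊛ Q) i j = ∑ (λ k → P i k * Q k j)

  _·_ : Carrier → M → M
  (a · P) i j = a * P i j

  ⊖_ : M → M
  (⊖ P) i j = - P i j

  𝟎 : M
  𝟎 i j = 0#

  𝐈 : M
  𝐈 i j = if ⌊ i ≟ j ⌋ then 1# else 0#

  _^_ : M → ℕ → M
  P ^ zero  = 𝐈
  P ^ suc m = P ⊛ (P ^ m)

  -- ∑_{h = a}^{a + len - 1} F h
  sumRange : ℕ → ℕ → (ℕ → M) → M
  sumRange a zero      F = 𝟎
  sumRange a (suc len) F = F a ⊕ sumRange (suc a) len F

  _≋_ : M → M → Set ℓ
  P ≋ Q = ∀ i j → P i j ≈ Q i j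

  bool : Bool → Carrier
  bool true  = 1#
  bool false = 0#

  module _ (Γ : Graph n) where
    Adist : ℕ → M
    Adist j u v = bool (atDist Γ j u v)

    A : M
    A = Adist 1

    Estar : Fin n → ℕ → M
    Estar x j u v = if ⌊ u ≟ v ⌋ then bool (atDist Γ j x u) else 0#

    Lmat : Fin n → ℕ → M
    Lmat x D = sumRange 1 D (λ h → Estar x (h ℕ.∸ 1) ⊛ (A ⊛ Estar x h))

    Rmat : Fin n → ℕ → M
    Rmat x D = sumRange 0 D (λ h → Estar x (suc h) ⊛ (A ⊛ Estar x h))

prodC : (ℕ → ℕ) → ℕ → ℕ
prodC c zero    = 1
prodC c (suc m) = c (suc m) ℕ.* prodC c m

module Submission where

-- The identity is proved entrywise.  Call ∂(x,u) the level of u, and say u covers k when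
-- they are adjacent and u is one level further from x.  Then R_{uk} = [u covers k], L is the
-- transpose of R, and (R^m)_{uv} = c_m⋯c_1 when u lies m levels above v at distance m from it
-- (0 otherwise), by induction on m since c_{m+1} = |Γ_m(v) ∩ Γ(u)|.  So every matrix in the
-- formula has (u,v)-entry [∂(x,v) = 2] times the size of a vertex set times a product of c's.
-- For ∂(x,v) = 2 these sets are empty unless ∂(x,u) = i and ∂(u,v) ∈ {i-2, i}, bipartiteness
-- ruling out i-1.  If ∂(u,v) = i, the c_i neighbours of u in Γ_{i-1}(v) either cover u or lie in
-- Γ_{i-1}(x), and the hypothesis on α_i, β_i closes the computation; if ∂(u,v) = i-2 the two
-- counts are b_i and c_2.

open import Defs
open import Data.Bool using (Bool; true; false; _∧_; _∨_; not; T; if_then_else_)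
open import Data.Bool.Properties using (T?)
import Data.Nat as Nat
open import Data.Nat using (ℕ; zero; suc; _≤_; _<_; _∸_; _≡ᵇ_; z≤n; s≤s)
import Data.Nat.Properties as ℕₚ
open import Data.Fin using (Fin; _≟_)
import Data.Fin as Fin
import Data.Fin.Properties
open Data.Fin.Properties using (toℕ<n)
open import Data.Product using (Σ; _×_; _,_; proj₁; proj₂)
open import Data.Sum using (_⊎_; inj₁; inj₂)
open import Data.Empty using (⊥; ⊥-elim)
open import Relation.Nullary using (¬_; Dec; yes; no)
open import Relation.Nullary.Decidable using (⌊_⌋; toWitness)
import Relation.Binary.PropositionalEquality as P
open import Algebra.Bundles using (CommutativeRing)
open P using (_≡_; _≢_)

module BoolFacts where
  open P using (refl)

  T-ext : ∀ {a b} → (T a → T b) → (T b → T a) → a ≡ b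
  T-ext {true}  {true}  _ _ = refl
  T-ext {true}  {false} f _ = ⊥-elim (f _)
  T-ext {false} {true}  _ g = ⊥-elim (g _)
  T-ext {false} {false} _ _ = refl

  ∧-intro : ∀ {a b} → T a → T b → T (a ∧ b)
  ∧-intro {true} _ tb = tb

  ∧-fst : ∀ a {b} → T (a ∧ b) → T a
  ∧-fst true _ = _

  ∧-snd : ∀ a {b} → T (a ∧ b) → T b
  ∧-snd true t = t

  ∨-inl : ∀ {a} b → T a → T (a ∨ b)
  ∨-inl {true} _ _ = _

  ∨-inr : ∀ a {b} → T b → T (a ∨ b)
  ∨-inr true  _ = _
  ∨-inr false t = t

  ∨-cases : ∀ a {b} → T (a ∨ b) → T a ⊎ T b
  ∨-cases true  _ = inj₁ _
  ∨-cases false t = inj₂ t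

  not-true : ∀ {a} → T (not a) → ¬ T a
  not-true {true} () _

  not-intro : ∀ {a} → ¬ T a → T (not a)
  not-intro {true}  f = f _
  not-intro {false} _ = _

  ⌊⌋-yes : ∀ {A : Set} (d : Dec A) → A → T ⌊ d ⌋
  ⌊⌋-yes (yes _) _ = _
  ⌊⌋-yes (no ¬a) a = ⊥-elim (¬a a)

  ⌊⌋-no : ∀ {A : Set} (d : Dec A) → ¬ A → ⌊ d ⌋ ≡ false
  ⌊⌋-no (yes a) ¬a = ⊥-elim (¬a a)
  ⌊⌋-no (no _)  _  = refl

open BoolFacts

module Counting where
  open P using (refl; cong)
  open Nat using (_+_)

  count-ext : ∀ {m} (p q : Fin m → Bool) → (∀ k → p k ≡ q k) → count p ≡ count q
  count-ext {zero}  p q e = refl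
  count-ext {suc m} p q e rewrite e Fin.zero = cong (_ +_) (count-ext _ _ (λ k → e (Fin.suc k)))

  count-cong : ∀ {m} (p q : Fin m → Bool) →
               (∀ k → T (p k) → T (q k)) → (∀ k → T (q k) → T (p k)) → count p ≡ count q
  count-cong p q to from = count-ext p q (λ k → T-ext (to k) (from k))

  count-none : ∀ {m} (p : Fin m → Bool) → (∀ k → ¬ T (p k)) → count p ≡ 0
  count-none {zero}  p h = refl
  count-none {suc m} p h with p Fin.zero | h Fin.zero
  ... | true  | h₀ = ⊥-elim (h₀ _)
  ... | false | _  = count-none _ (λ k → h (Fin.suc k))

  count-split : ∀ {m} (p q : Fin m → Bool) →
                count p ≡ count (λ k → p k ∧ q k) + count (λ k → p k ∧ not (q k))
  count-split {zero}  p q = refl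
  count-split {suc m} p q with p Fin.zero | q Fin.zero
  ... | false | _     = count-split (λ k → p (Fin.suc k)) (λ k → q (Fin.suc k))
  ... | true  | true  = cong suc (count-split (λ k → p (Fin.suc k)) (λ k → q (Fin.suc k)))
  ... | true  | false = P.trans (cong suc (count-split (λ k → p (Fin.suc k)) (λ k → q (Fin.suc k))))
                                (P.sym (ℕₚ.+-suc _ _))

open Counting

module Search where
  open Nat using (_+_)
  open P using (refl; sym; trans)
  open ℕₚ using (≤-trans; ≤-reflexive; <⇒≱; m≤n⇒m<n∨m≡n; +-suc)

  search-least : ∀ p s f j → s ≤ j → T (p j) → search p s f ≤ j
  search-least p s zero    j s≤j _ = s≤j
  search-least p s (suc f) j s≤j t with p s in eq
  ... | true  = s≤j
  ... | false with m≤n⇒m<n∨m≡n s≤j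
  ...   | inj₁ s<j  = search-least p (suc s) f j s<j t
  ...   | inj₂ refl = ⊥-elim (P.subst T eq t)

  search-bounded : ∀ p s f → search p s f ≤ s + f
  search-bounded p s zero    = ≤-reflexive (sym (ℕₚ.+-identityʳ s))
  search-bounded p s (suc f) with p s
  ... | true  = ℕₚ.m≤m+n s (suc f)
  ... | false = ≤-trans (search-bounded p (suc s) f) (≤-reflexive (sym (+-suc s f)))

  search-found : ∀ p s f → search p s f < s + f → T (p (search p s f))
  search-found p s zero    lt = ⊥-elim (ℕₚ.<-irrefl (sym (ℕₚ.+-identityʳ s)) lt)
  search-found p s (suc f) lt with p s in eq
  ... | true  = P.subst T (sym eq) _
  ... | false = search-found p (suc s) f (≤-trans lt (≤-reflexive (+-suc s f)))

  search-minimal : ∀ p s f j → s ≤ j → j < search p s f → p j ≡ false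
  search-minimal p s zero    j s≤j lt = ⊥-elim (<⇒≱ lt s≤j)
  search-minimal p s (suc f) j s≤j lt with p s in eq
  ... | true  = ⊥-elim (<⇒≱ lt s≤j)
  ... | false with m≤n⇒m<n∨m≡n s≤j
  ...   | inj₁ s<j  = search-minimal p (suc s) f j s<j lt
  ...   | inj₂ refl = eq

module Exists where
  anyV-intro : ∀ {m} (p : Fin m → Bool) w → T (p w) → T (anyV p)
  anyV-intro p Fin.zero    t = ∨-inl _ t
  anyV-intro p (Fin.suc w) t = ∨-inr (p Fin.zero) (anyV-intro (λ i → p (Fin.suc i)) w t)

  anyV-elim : ∀ {m} (p : Fin m → Bool) → T (anyV p) → Σ (Fin m) (λ w → T (p w))
  anyV-elim {suc m} p t with ∨-cases (p Fin.zero) t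
  ... | inj₁ t₀ = Fin.zero , t₀
  ... | inj₂ t₁ with anyV-elim (λ i → p (Fin.suc i)) t₁
  ...   | w , tw = Fin.suc w , tw

module Metric {n : ℕ} (Γ : Graph n) where
  open Graph Γ
  open Search
  open Exists
  open Nat using (_+_)
  open P using (refl; sym; trans; cong; subst; subst₂)
  open ℕₚ using (≤-trans; ≤-reflexive; ≤-antisym; <⇒≱; m≤n⇒m<n∨m≡n; +-suc)

  walk : ℕ → Fin n → Fin n → Bool
  walk = reach Γ

  ∂ : Fin n → Fin n → ℕ
  ∂ = dist Γ

  walk-weaken : ∀ j u v → T (walk j u v) → T (walk (suc j) u v)
  walk-weaken j u v = ∨-inl _

  walk-refl : ∀ u → T (walk 0 u u)
  walk-refl u = ⌊⌋-yes (u ≟ u) refl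

  walk-snoc : ∀ j u a b → T (walk j u a) → T (adj a b) → T (walk (suc j) u b)
  walk-snoc zero u a b t ab with toWitness {a? = u ≟ a} t
  ... | refl = ∨-inr (walk 0 u b) (anyV-intro (λ w → adj u w ∧ walk 0 w b) b (∧-intro ab (walk-refl b)))
  walk-snoc (suc j) u a b t ab with ∨-cases (walk j u a) t
  ... | inj₁ t₁ = walk-weaken (suc j) u b (walk-snoc j u a b t₁ ab)
  ... | inj₂ t₂ with anyV-elim (λ w → adj u w ∧ walk j w a) t₂
  ...   | w , tw = ∨-inr (walk (suc j) u b) (anyV-intro (λ w → adj u w ∧ walk (suc j) w b) w
                     (∧-intro (∧-fst (adj u w) tw) (walk-snoc j w a b (∧-snd (adj u w) tw) ab)))

  walk-append : ∀ a b u v w → T (walk a u v) → T (walk b v w) → T (walk (a + b) u w)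
  walk-append zero b u v w t₁ t₂ with toWitness {a? = u ≟ v} t₁
  ... | refl = t₂
  walk-append (suc a) b u v w t₁ t₂ with ∨-cases (walk a u v) t₁
  ... | inj₁ t = walk-weaken (a + b) u w (walk-append a b u v w t t₂)
  ... | inj₂ t with anyV-elim (λ z → adj u z ∧ walk a z v) t
  ...   | z , tz = ∨-inr (walk (a + b) u w) (anyV-intro (λ z → adj u z ∧ walk (a + b) z w) z
                     (∧-intro (∧-fst (adj u z) tz) (walk-append a b z v w (∧-snd (adj u z) tz) t₂)))

  walk-sym : ∀ j u v → T (walk j u v) → T (walk j v u)
  walk-sym zero u v t with toWitness {a? = u ≟ v} t
  ... | refl = t
  walk-sym (suc j) u v t with ∨-cases (walk j u v) t
  ... | inj₁ t₁ = walk-weaken j v u (walk-sym j u v t₁)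
  ... | inj₂ t₂ with anyV-elim (λ w → adj u w ∧ walk j w v) t₂
  ...   | w , tw = walk-snoc j v w u (walk-sym j w v (∧-snd (adj u w) tw))
                     (subst T (symmetric u w) (∧-fst (adj u w) tw))

  ∂-least : ∀ j u v → T (walk j u v) → ∂ u v ≤ j
  ∂-least j u v = search-least (λ j → walk j u v) 0 n j z≤n

  ∂-bounded : ∀ u v → ∂ u v ≤ n
  ∂-bounded u v = search-bounded (λ j → walk j u v) 0 n

  ∂-walk : ∀ u v → ∂ u v < n → T (walk (∂ u v) u v)
  ∂-walk u v = search-found (λ j → walk j u v) 0 n

  ∂-no-shorter : ∀ j u v → j < ∂ u v → walk j u v ≡ false
  ∂-no-shorter j u v = search-minimal (λ j → walk j u v) 0 n j z≤n

  ∂-sym≤ : ∀ u v → ∂ v u ≤ ∂ u v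
  ∂-sym≤ u v with m≤n⇒m<n∨m≡n (∂-bounded u v)
  ... | inj₁ lt = ∂-least (∂ u v) v u (walk-sym (∂ u v) u v (∂-walk u v lt))
  ... | inj₂ eq = ≤-trans (∂-bounded v u) (≤-reflexive (sym eq))

  ∂-sym : ∀ u v → ∂ u v ≡ ∂ v u
  ∂-sym u v = ≤-antisym (∂-sym≤ v u) (∂-sym≤ u v)

  ∂-triangle : ∀ u v w → ∂ u w ≤ ∂ u v + ∂ v w
  ∂-triangle u v w with m≤n⇒m<n∨m≡n (∂-bounded u v) | m≤n⇒m<n∨m≡n (∂-bounded v w)
  ... | inj₁ l₁ | inj₁ l₂ = ∂-least _ u w (walk-append (∂ u v) (∂ v w) u v w (∂-walk u v l₁) (∂-walk v w l₂))
  ... | inj₂ e  | _       = ≤-trans (∂-bounded u w) (≤-trans (≤-reflexive (sym e)) (ℕₚ.m≤m+n _ _))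
  ... | _       | inj₂ e  = ≤-trans (∂-bounded u w) (≤-trans (≤-reflexive (sym e)) (ℕₚ.m≤n+m _ _))

  ∂-self : ∀ u → ∂ u u ≡ 0
  ∂-self u = ≤-antisym (∂-least 0 u u (walk-refl u)) z≤n

  ∂-zero : ∀ u v → ∂ u v ≡ 0 → u ≡ v
  ∂-zero u v e = toWitness {a? = u ≟ v}
    (subst (λ j → T (walk j u v)) e (∂-walk u v (subst (_< n) (sym e) (ℕₚ.≤-<-trans z≤n (toℕ<n u)))))

  -- Adjacency is distance one; the converse uses n > 1 so that ∂(u,v) = 1 is witnessed by a walk.
  adj⇒∂≡1 : ∀ u v → T (adj u v) → ∂ u v ≡ 1
  adj⇒∂≡1 u v t with ∂ u v in e | ∂-least 1 u v (walk-snoc 0 u u v (walk-refl u) t)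
  ... | zero | _ with ∂-zero u v e
  ...   | refl = ⊥-elim (subst T (loopless u) t)
  adj⇒∂≡1 u v t | suc zero    | _ = refl
  adj⇒∂≡1 u v t | suc (suc _) | s≤s ()

  ∂-step : ∀ u v w → T (adj v w) → ∂ u w ≤ suc (∂ u v)
  ∂-step u v w t = ≤-trans (∂-triangle u v w)
    (≤-reflexive (trans (cong (∂ u v +_) (adj⇒∂≡1 v w t)) (ℕₚ.+-comm (∂ u v) 1)))

  first-step : ∀ j u v → ∂ u v ≡ suc j → suc j < n → Σ (Fin n) (λ w → T (adj u w) × ∂ w v ≡ j)
  first-step j u v e lt
    with ∨-cases (walk j u v) (subst (λ k → T (walk k u v)) e (∂-walk u v (subst (_< n) (sym e) lt)))
  ... | inj₁ t = ⊥-elim (subst T (∂-no-shorter j u v (≤-reflexive (sym e))) t)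
  ... | inj₂ t with anyV-elim (λ w → adj u w ∧ walk j w v) t
  ...   | w , tw = w , ∧-fst (adj u w) tw , ≤-antisym (∂-least j w v (∧-snd (adj u w) tw)) closer
    where
    back : ∂ u v ≤ suc (∂ w v)
    back = subst₂ _≤_ (∂-sym v u) (cong suc (∂-sym v w))
                 (∂-step v w u (subst T (symmetric u w) (∧-fst (adj u w) tw)))
    closer : j ≤ ∂ w v
    closer = ℕₚ.≤-pred (subst (_≤ suc (∂ w v)) e back)

  ∂≡1⇒adj : ∀ u v → ∂ u v ≡ 1 → 1 < n → T (adj u v)
  ∂≡1⇒adj u v e lt with first-step 0 u v e lt
  ... | w , t , e₀ with ∂-zero w v e₀
  ...   | refl = t

  -- In a bipartite graph the distance from any vertex u changes along every edge.
  module Parity (side : Fin n → Bool)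
                (bip : ∀ u v → T (adj u v) → side u ≡ (if side v then false else true)) where

    flips : ℕ → Bool → Bool
    flips zero    b = b
    flips (suc j) b = not (flips j b)

    flips-not : ∀ j b → flips j (not b) ≡ not (flips j b)
    flips-not zero    b = refl
    flips-not (suc j) b = cong not (flips-not j b)

    side-adj : ∀ u v → T (adj u v) → side v ≡ not (side u)
    side-adj u v t with side u | side v | bip u v t
    ... | true  | false | _ = refl
    ... | false | true  | _ = refl

    side-∂ : ∀ j u v → ∂ u v ≡ j → j < n → side v ≡ flips j (side u)
    side-∂ zero u v e lt with ∂-zero u v e
    ... | refl = refl
    side-∂ (suc j) u v e lt with first-step j u v e lt
    ... | w , t , e′ = trans (side-∂ j w v e′ (≤-trans (ℕₚ.n≤1+n _) lt))
                             (trans (cong (flips j) (side-adj u w t)) (flips-not j (side u)))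

    adjacent-not-equidistant : ∀ u a b → T (adj a b) → ∂ u a ≡ ∂ u b → ∂ u a < n → ⊥
    adjacent-not-equidistant u a b t e lt =
      b≢¬b (side a) (trans (side-∂ _ u a refl lt) (sym (side-∂ _ u b (sym e) lt))) (side-adj a b t)
      where
      b≢¬b : ∀ x {y} → x ≡ y → y ≡ not x → ⊥
      b≢¬b true  refl ()
      b≢¬b false refl ()

    ∂-edge : ∀ w a b → T (adj a b) → ∂ w a < n → ∂ w b ≡ suc (∂ w a) ⊎ ∂ w a ≡ suc (∂ w b)
    ∂-edge w a b t lt with m≤n⇒m<n∨m≡n (∂-step w a b t)
    ... | inj₂ e = inj₁ e
    ... | inj₁ b≤a = inj₂ (≤-antisym (∂-step w b a (subst T (symmetric a b) t))
                                     (ℕₚ.≤∧≢⇒< (ℕₚ.≤-pred b≤a) (λ e → adjacent-not-equidistant w a b t (sym e) lt)))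

module MatrixFacts {c ℓ} (ℛ : CommutativeRing c ℓ) (n : ℕ) where
  open CommutativeRing ℛ
  open Mat ℛ n
  open import Relation.Binary.Reasoning.Setoid setoid
  open ℕₚ using (≤-trans; ≤-reflexive; <-irrefl; <⇒≱; m≤n⇒m<n∨m≡n; +-suc)

  fromℕ-+ : ∀ a b → fromℕ (a Nat.+ b) ≈ fromℕ a + fromℕ b
  fromℕ-+ zero    b = sym (+-identityˡ _)
  fromℕ-+ (suc a) b = trans (+-cong refl (fromℕ-+ a b)) (sym (+-assoc _ _ _))

  fromℕ-* : ∀ a b → fromℕ (a Nat.* b) ≈ fromℕ a * fromℕ b
  fromℕ-* zero    b = sym (zeroˡ _)
  fromℕ-* (suc a) b = begin
    fromℕ (b Nat.+ a Nat.* b)         ≈⟨ fromℕ-+ b (a Nat.* b) ⟩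
    fromℕ b + fromℕ (a Nat.* b)       ≈⟨ +-cong (sym (*-identityˡ _)) (fromℕ-* a b) ⟩
    1# * fromℕ b + fromℕ a * fromℕ b  ≈⟨ sym (distribʳ _ _ _) ⟩
    (1# + fromℕ a) * fromℕ b          ∎

  fromℕ-indicator : ∀ b → fromℕ (if b then 1 else 0) ≈ bool b
  fromℕ-indicator true  = +-identityʳ 1#
  fromℕ-indicator false = refl

  bool-true : ∀ {b} → T b → bool b ≈ 1#
  bool-true {true} _ = refl

  bool-false : ∀ {b} → ¬ T b → bool b ≈ 0#
  bool-false {true}  f = ⊥-elim (f _)
  bool-false {false} _ = refl

  bool-∧ : ∀ a b → bool (a ∧ b) ≈ bool a * bool b
  bool-∧ true  b = sym (*-identityˡ _)
  bool-∧ false b = sym (zeroˡ _)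

  ≡ᵇ-yes : ∀ {a b} → a ≡ b → bool (a ≡ᵇ b) ≈ 1#
  ≡ᵇ-yes {a} {b} e = bool-true (ℕₚ.≡⇒≡ᵇ a b e)

  ≡ᵇ-no : ∀ {a b} → a ≢ b → bool (a ≡ᵇ b) ≈ 0#
  ≡ᵇ-no {a} {b} ne = bool-false (λ t → ne (ℕₚ.≡ᵇ⇒≡ a b t))

  ≡ᵇ-⇔ : ∀ {a b c d} → (a ≡ b → c ≡ d) → (c ≡ d → a ≡ b) → bool (a ≡ᵇ b) ≈ bool (c ≡ᵇ d)
  ≡ᵇ-⇔ {a} {b} {c} {d} to from = reflexive (P.cong bool
    (T-ext (λ t → ℕₚ.≡⇒≡ᵇ c d (to (ℕₚ.≡ᵇ⇒≡ a b t))) (λ t → ℕₚ.≡⇒≡ᵇ a b (from (ℕₚ.≡ᵇ⇒≡ c d t)))))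

  ∑-zero : ∀ {m} (f : Fin m → Carrier) → (∀ k → f k ≈ 0#) → ∑ f ≈ 0#
  ∑-zero {zero}  f e = refl
  ∑-zero {suc m} f e = trans (+-cong (e Fin.zero) (∑-zero _ (λ k → e (Fin.suc k)))) (+-identityˡ 0#)

  ∑-single : ∀ {m} (f : Fin m → Carrier) (u : Fin m) → (∀ k → k ≢ u → f k ≈ 0#) → ∑ f ≈ f u
  ∑-single {suc m} f Fin.zero e =
    trans (+-cong refl (∑-zero _ (λ k → e (Fin.suc k) (λ ())))) (+-identityʳ _)
  ∑-single {suc m} f (Fin.suc u) e =
    trans (+-cong (e Fin.zero (λ ()))
                  (∑-single _ u (λ k k≢u → e (Fin.suc k) (λ eq → k≢u (Data.Fin.Properties.suc-injective eq)))))
          (+-identityˡ _)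

  ∑-indicator : ∀ {m} (f : Fin m → Carrier) (q : Fin m → Bool) a →
                (∀ k → f k ≈ bool (q k) * a) → ∑ f ≈ fromℕ (count q) * a
  ∑-indicator {zero}  f q a e = sym (zeroˡ a)
  ∑-indicator {suc m} f q a e = begin
    f Fin.zero + ∑ (λ k → f (Fin.suc k))
      ≈⟨ +-cong (e Fin.zero) (∑-indicator _ (λ k → q (Fin.suc k)) a (λ k → e (Fin.suc k))) ⟩
    bool (q Fin.zero) * a + fromℕ (count (λ k → q (Fin.suc k))) * a
      ≈⟨ sym (distribʳ _ _ _) ⟩
    (bool (q Fin.zero) + fromℕ (count (λ k → q (Fin.suc k)))) * a
      ≈⟨ *-cong (+-cong (sym (fromℕ-indicator (q Fin.zero))) refl) refl ⟩
    (fromℕ (if q Fin.zero then 1 else 0) + fromℕ (count (λ k → q (Fin.suc k)))) * a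
      ≈⟨ *-cong (sym (fromℕ-+ (if q Fin.zero then 1 else 0) (count (λ k → q (Fin.suc k))))) refl ⟩
    fromℕ (count q) * a ∎

  sumRange-vanish : ∀ (F : ℕ → M) u v a len →
                    (∀ h → a ≤ h → h < a Nat.+ len → F h u v ≈ 0#) → sumRange a len F u v ≈ 0#
  sumRange-vanish F u v a zero      z = refl
  sumRange-vanish F u v a (suc len) z =
    trans (+-cong (z a ℕₚ.≤-refl (ℕₚ.m<m+n a (s≤s z≤n)))
                  (sumRange-vanish F u v (suc a) len
                     (λ h a<h lt → z h (ℕₚ.<⇒≤ a<h) (≤-trans lt (≤-reflexive (P.sym (+-suc a len)))))))
          (+-identityˡ 0#)

  sumRange-single : ∀ (F : ℕ → M) u v t a len → (∀ h → h ≢ t → F h u v ≈ 0#) →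
                    a ≤ t → t < a Nat.+ len → sumRange a len F u v ≈ F t u v
  sumRange-single F u v t a zero      z a≤t t<a = ⊥-elim (<⇒≱ t<a (≤-trans (≤-reflexive (ℕₚ.+-identityʳ a)) a≤t))
  sumRange-single F u v t a (suc len) z a≤t t< with m≤n⇒m<n∨m≡n a≤t
  ... | inj₂ P.refl =
    trans (+-cong refl (sumRange-vanish F u v (suc a) len (λ h a<h _ → z h (λ h≡a → <-irrefl (P.sym h≡a) a<h))))
          (+-identityʳ _)
  ... | inj₁ a<t =
    trans (+-cong (z a (λ a≡t → <-irrefl a≡t a<t))
                  (sumRange-single F u v t (suc a) len z a<t (≤-trans t< (≤-reflexive (+-suc a len)))))
          (+-identityˡ _)

module RingIdentities {c ℓ} (ℛ : CommutativeRing c ℓ) where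
  open CommutativeRing ℛ
  open import Algebra.Properties.Ring ring using (-0#≈0#; -‿distribˡ-*)
  open import Relation.Binary.Reasoning.Setoid setoid
  open import Algebra.Solver.Ring.NaturalCoefficients.Default commutativeSemiring
    using (solve; _:=_; _:+_; _:*_)

  +-cancel : ∀ x y → (x + y) + - y ≈ x
  +-cancel x y = trans (+-assoc x y (- y)) (trans (+-cong refl (-‿inverseʳ y)) (+-identityʳ x))

  annihilate : ∀ {a b} → b ≈ 0# → a * b ≈ 0#
  annihilate b≈0 = trans (*-cong refl b≈0) (zeroʳ _)

  sum-vanishes : ∀ {a b c} → a ≈ 0# → b ≈ 0# → c ≈ 0# → a + (- b + c) ≈ 0#
  sum-vanishes a≈0 b≈0 c≈0 =
    trans (+-cong a≈0 (+-cong (trans (-‿cong b≈0) -0#≈0#) c≈0)) (trans (+-identityˡ _) (+-identityˡ 0#))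

  -- The right-hand side of Lemma 7.2, evaluated at one entry: with P = c_{i-1}⋯c_1,
  -- P′ = c_{i-2}⋯c_1, the entry of E*_i A_i E*_2 being t₁, that of R^{i-1}LE*_2
  -- being N·P and that of R^{i-2}E*_2 being t₃·P′.
  module Combination (P P′ cᵢ cᵢ₋₁ bᵢ c₂ α β : Carrier) where
    coef₁ coef₃ : Carrier
    coef₁ = P * (cᵢ - α)
    coef₃ = cᵢ₋₁ * (bᵢ + β * c₂)

    combination : Carrier → Carrier → Carrier → Carrier
    combination t₁ N t₃ = coef₁ * t₁ + (- (β * (N * P)) + coef₃ * (t₃ * P′))

    combination-vanish : ∀ {K t₁ N t₃} → K ≈ 0# → t₁ ≈ 0# → N ≈ 0# → t₃ ≈ 0# →
                         K * P ≈ combination t₁ N t₃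
    combination-vanish K≈0 t₁≈0 N≈0 t₃≈0 =
      trans (trans (*-cong K≈0 refl) (zeroˡ P))
            (sym (sum-vanishes (annihilate t₁≈0) (annihilate (trans (*-cong N≈0 refl) (zeroˡ P)))
                               (annihilate (trans (*-cong t₃≈0 refl) (zeroˡ P′)))))

    combination-first : ∀ {K M t₁ N t₃} → cᵢ ≈ K + M → α + β * N ≈ M → t₁ ≈ 1# → t₃ ≈ 0# →
                        K * P ≈ combination t₁ N t₃
    combination-first {K} {M} {t₁} {N} {t₃} cᵢ≈ hyp t₁≈1 t₃≈0 = sym (begin
      combination t₁ N t₃
        ≈⟨ +-cong (trans (*-cong refl t₁≈1) (*-identityʳ coef₁))
                  (trans (+-cong refl (trans (*-cong refl (trans (*-cong t₃≈0 refl) (zeroˡ P′))) (zeroʳ coef₃)))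
                         (+-identityʳ _)) ⟩
      P * (cᵢ - α) + - (β * (N * P))          ≈⟨ +-cong (*-cong refl cᵢ-α) refl ⟩
      P * (K + β * N) + - (β * (N * P))       ≈⟨ +-cong (expand P K β N) refl ⟩
      (K * P + β * (N * P)) + - (β * (N * P)) ≈⟨ +-cancel (K * P) (β * (N * P)) ⟩
      K * P                                   ∎)
      where
      expand : ∀ P K β N → P * (K + β * N) ≈ K * P + β * (N * P)
      expand = solve 4 (λ P K β N → P :* (K :+ β :* N) := K :* P :+ β :* (N :* P)) refl
      regroup : ∀ K α βN → K + (α + βN) ≈ (K + βN) + α
      regroup = solve 3 (λ K α βN → K :+ (α :+ βN) := (K :+ βN) :+ α) refl
      cᵢ-α : cᵢ - α ≈ K + β * N
      cᵢ-α = trans (+-cong (trans cᵢ≈ (trans (+-cong refl (sym hyp)) (regroup K α (β * N)))) refl)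
                   (+-cancel (K + β * N) α)

    combination-rest : ∀ {K t₁ N t₃} → K ≈ bᵢ → N ≈ c₂ → P ≈ cᵢ₋₁ * P′ → t₁ ≈ 0# → t₃ ≈ 1# →
                       K * P ≈ combination t₁ N t₃
    combination-rest {K} {t₁} {N} {t₃} K≈b N≈c₂ P≈ t₁≈0 t₃≈1 = sym (begin
      combination t₁ N t₃
        ≈⟨ trans (+-cong (trans (*-cong refl t₁≈0) (zeroʳ coef₁)) refl) (+-identityˡ _) ⟩
      - (β * (N * P)) + coef₃ * (t₃ * P′)
        ≈⟨ +-cong (-‿cong (*-cong refl (*-cong N≈c₂ P≈))) (*-cong refl (trans (*-cong t₃≈1 refl) (*-identityˡ P′))) ⟩
      - (β * (c₂ * (cᵢ₋₁ * P′))) + coef₃ * P′                              ≈⟨ +-comm _ _ ⟩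
      coef₃ * P′ + - (β * (c₂ * (cᵢ₋₁ * P′)))                              ≈⟨ +-cong (expand cᵢ₋₁ bᵢ β c₂ P′) refl ⟩
      (bᵢ * (cᵢ₋₁ * P′) + β * (c₂ * (cᵢ₋₁ * P′))) + - (β * (c₂ * (cᵢ₋₁ * P′))) ≈⟨ +-cancel _ _ ⟩
      bᵢ * (cᵢ₋₁ * P′)                                                     ≈⟨ *-cong (sym K≈b) (sym P≈) ⟩
      K * P                                                                ∎)
      where
      expand : ∀ c b β c₂ P′ → (c * (b + β * c₂)) * P′ ≈ b * (c * P′) + β * (c₂ * (c * P′))
      expand = solve 5 (λ c b β c₂ P′ → (c :* (b :+ β :* c₂)) :* P′ := b :* (c :* P′) :+ β :* (c₂ :* (c :* P′))) refl

    -- The entry (u,v) of the right-hand side is a combination multiplied by the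
    -- indicator e of ∂(x,v) = 2, with t₁ = I·J the product of the indicators of
    -- ∂(x,u) = i and ∂(u,v) = i coming from E*_i A_i.
    scaled : Carrier → Carrier → Carrier → Carrier → Carrier → Carrier
    scaled I J N t₃ e = coef₁ * (I * (J * e)) + (- (β * (N * (P * e))) + coef₃ * ((t₃ * P′) * e))

    combination-scale : ∀ {K I J N t₃} e → K * P ≈ combination (I * J) N t₃ → K * (P * e) ≈ scaled I J N t₃ e
    combination-scale {K} {I} {J} {N} {t₃} e eq = begin
      K * (P * e)                                  ≈⟨ sym (*-assoc K P e) ⟩
      (K * P) * e                                  ≈⟨ *-cong eq refl ⟩
      combination (I * J) N t₃ * e                 ≈⟨ trans (distribʳ e _ _) (+-cong refl (distribʳ e _ _)) ⟩
      coef₁ * (I * J) * e + (- (β * (N * P)) * e + coef₃ * (t₃ * P′) * e)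
        ≈⟨ +-cong (re₁ coef₁ I J e) (+-cong (trans (sym (-‿distribˡ-* _ e)) (-‿cong (re₂ β N P e))) (re₃ coef₃ t₃ P′ e)) ⟩
      scaled I J N t₃ e                            ∎
      where
      re₁ : ∀ a I J e → a * (I * J) * e ≈ a * (I * (J * e))
      re₁ = solve 4 (λ a I J e → a :* (I :* J) :* e := a :* (I :* (J :* e))) refl
      re₂ : ∀ β N P e → (β * (N * P)) * e ≈ β * (N * (P * e))
      re₂ = solve 4 (λ β N P e → (β :* (N :* P)) :* e := β :* (N :* (P :* e))) refl
      re₃ : ∀ a t P′ e → a * (t * P′) * e ≈ a * ((t * P′) * e)
      re₃ = solve 4 (λ a t P′ e → a :* (t :* P′) :* e := a :* ((t :* P′) :* e)) refl

    scaled-null : ∀ K I J N t₃ {e} → e ≈ 0# → K * (P * e) ≈ scaled I J N t₃ e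
    scaled-null K I J N t₃ e≈0 =
      trans (annihilate (annihilate e≈0))
            (sym (sum-vanishes (annihilate (annihilate (annihilate e≈0)))
                               (annihilate (annihilate (annihilate e≈0)))
                               (annihilate (annihilate e≈0))))

module Layers {n : ℕ} (Γ : Graph n) (x : Fin n) where
  open Graph Γ
  open Metric Γ
  open Nat using (_+_)
  open P using (refl; sym; trans; cong; subst; subst₂)
  open ℕₚ using (≤-trans; ≤-reflexive; ≤-antisym; +-suc)

  lvl : Fin n → ℕ
  lvl = ∂ x

  -- u is adjacent to k and one level further from x: the support of R.
  covers : Fin n → Fin n → Bool
  covers u k = atDist Γ 1 u k ∧ (lvl u ≡ᵇ suc (lvl k))

  -- u lies m levels above v and at distance m from it, i.e. on a geodesic
  -- from x through v: the support of R^m.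
  above : ℕ → Fin n → Fin n → Bool
  above m u v = (lvl u ≡ᵇ lvl v + m) ∧ atDist Γ m v u

  covers-elim : ∀ u k → T (covers u k) → ∂ u k ≡ 1 × lvl u ≡ suc (lvl k)
  covers-elim u k t = ℕₚ.≡ᵇ⇒≡ (∂ u k) 1 (∧-fst (atDist Γ 1 u k) t)
                    , ℕₚ.≡ᵇ⇒≡ (lvl u) _ (∧-snd (atDist Γ 1 u k) t)

  covers-intro : ∀ u k → ∂ u k ≡ 1 → lvl u ≡ suc (lvl k) → T (covers u k)
  covers-intro u k e₁ e₂ = ∧-intro (ℕₚ.≡⇒≡ᵇ (∂ u k) 1 e₁) (ℕₚ.≡⇒≡ᵇ (lvl u) _ e₂)

  above-elim : ∀ m u v → T (above m u v) → lvl u ≡ lvl v + m × ∂ v u ≡ m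
  above-elim m u v t = ℕₚ.≡ᵇ⇒≡ (lvl u) _ (∧-fst (lvl u ≡ᵇ lvl v + m) t)
                     , ℕₚ.≡ᵇ⇒≡ (∂ v u) m (∧-snd (lvl u ≡ᵇ lvl v + m) t)

  above-intro : ∀ m u v → lvl u ≡ lvl v + m → ∂ v u ≡ m → T (above m u v)
  above-intro m u v e₁ e₂ = ∧-intro (ℕₚ.≡⇒≡ᵇ (lvl u) _ e₁) (ℕₚ.≡⇒≡ᵇ (∂ v u) m e₂)

  lvl-≤ : ∀ u v → lvl v ≤ lvl u + ∂ u v
  lvl-≤ u v = ∂-triangle x u v

  -- Stepping down: the vertices covered by u that lie m levels above v.  When u
  -- itself lies m + 1 levels above v they are exactly Γ_m(v) ∩ Γ(u), so there are
  -- c_{m+1} of them; otherwise there are none.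
  module Descent (1<n : 1 < n) (cc : ℕ → ℕ)
    (hc : ∀ j u w → dist Γ u w ≡ j → 1 ≤ j → count (λ z → atDist Γ (j ∸ 1) u z ∧ adj w z) ≡ cc j) where

    step : ℕ → Fin n → Fin n → Fin n → Bool
    step m u v k = covers u k ∧ above m k v

    step-support : ∀ m u v k → T (step m u v k) → T (above (suc m) u v)
    step-support m u v k t with covers-elim u k (∧-fst (covers u k) t) | above-elim m k v (∧-snd (covers u k) t)
    ... | ∂uk , lu | lk , ∂vk = above-intro (suc m) u v lu′ (≤-antisym upper lower)
      where
      lu′ : lvl u ≡ lvl v + suc m
      lu′ = trans lu (trans (cong suc lk) (sym (+-suc (lvl v) m)))
      upper : ∂ v u ≤ suc m
      upper = ≤-trans (∂-triangle v k u)
                (≤-reflexive (trans (P.cong₂ _+_ ∂vk (trans (∂-sym k u) ∂uk)) (ℕₚ.+-comm m 1)))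
      lower : suc m ≤ ∂ v u
      lower = ℕₚ.+-cancelˡ-≤ (lvl v) _ _ (subst (_≤ lvl v + ∂ v u) lu′ (lvl-≤ v u))

    step-count : ∀ m u v → T (above (suc m) u v) → count (step m u v) ≡ cc (suc m)
    step-count m u v t with above-elim (suc m) u v t
    ... | lu , ∂vu = trans (count-cong (step m u v) (λ k → atDist Γ m v k ∧ adj u k) to from)
                           (hc (suc m) v u ∂vu (s≤s z≤n))
      where
      to : ∀ k → T (step m u v k) → T (atDist Γ m v k ∧ adj u k)
      to k t with covers-elim u k (∧-fst (covers u k) t) | above-elim m k v (∧-snd (covers u k) t)
      ... | ∂uk , _ | _ , ∂vk = ∧-intro (ℕₚ.≡⇒≡ᵇ (∂ v k) m ∂vk) (∂≡1⇒adj u k ∂uk 1<n)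
      from : ∀ k → T (atDist Γ m v k ∧ adj u k) → T (step m u v k)
      from k t = ∧-intro (covers-intro u k (adj⇒∂≡1 u k uk) lu≡) (above-intro m k v lk≡ ∂vk)
        where
        ∂vk : ∂ v k ≡ m
        ∂vk = ℕₚ.≡ᵇ⇒≡ (∂ v k) m (∧-fst (atDist Γ m v k) t)
        uk : T (adj u k)
        uk = ∧-snd (atDist Γ m v k) t
        lk≤ : lvl k ≤ lvl v + m
        lk≤ = subst (λ d → lvl k ≤ lvl v + d) ∂vk (lvl-≤ v k)
        lu≤ : lvl u ≤ suc (lvl k)
        lu≤ = ∂-step x k u (subst T (symmetric u k) uk)
        lk≡ : lvl k ≡ lvl v + m
        lk≡ = ≤-antisym lk≤ (ℕₚ.≤-pred (subst (_≤ suc (lvl k)) (trans lu (+-suc (lvl v) m)) lu≤))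
        lu≡ : lvl u ≡ suc (lvl k)
        lu≡ = trans lu (trans (+-suc (lvl v) m) (cong suc (sym lk≡)))

  -- The vertex sets counted by the (u,v)-entries of LR^{i-1}E*_2 and R^{i-1}LE*_2 for
  -- i = p + 2, and their sizes when ∂(x,v) = 2, for Γ bipartite and distance-regular.
  module LevelTwo (1<n : 1 < n) (side : Fin n → Bool)
    (bip : ∀ u v → T (adj u v) → side u ≡ (if side v then false else true))
    (cc bb : ℕ → ℕ)
    (hc : ∀ j u w → dist Γ u w ≡ j → 1 ≤ j → count (λ z → atDist Γ (j ∸ 1) u z ∧ adj w z) ≡ cc j)
    (hb : ∀ j u w → dist Γ u w ≡ j → count (λ z → atDist Γ (suc j) u z ∧ adj w z) ≡ bb j)
    (p : ℕ) (i<n : suc (suc p) < n) where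
    open Parity side bip

    i m : ℕ
    i = suc (suc p)
    m = suc p

    m<n : m < n
    m<n = ≤-trans (ℕₚ.n≤1+n _) i<n

    -- Separates i - 1 from i + 1 and i - 2 from i.
    two-apart : ∀ a → a ≢ suc (suc a)
    two-apart zero    ()
    two-apart (suc a) e = two-apart a (ℕₚ.suc-injective e)

    outer : Fin n → Fin n → Fin n → Bool
    outer u v k = covers k u ∧ above m k v

    inner : Fin n → Fin n → Fin n → Bool
    inner u v k = above m u k ∧ covers v k

    outer-support : ∀ u v → lvl v ≡ 2 → ∀ k → T (outer u v k) → lvl u ≡ i × (∂ v u ≡ i ⊎ ∂ v u ≡ p)
    outer-support u v lv k t with covers-elim k u (∧-fst (covers k u) t) | above-elim m k v (∧-snd (covers k u) t)
    ... | ∂ku , lk | lk′ , ∂vk = lu , along-edge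
      where
      lu : lvl u ≡ i
      lu = ℕₚ.suc-injective (trans (sym lk) (trans lk′ (cong (_+ m) lv)))
      along-edge : ∂ v u ≡ i ⊎ ∂ v u ≡ p
      along-edge with ∂-edge v k u (∂≡1⇒adj k u ∂ku 1<n) (subst (_< n) (sym ∂vk) m<n)
      ... | inj₁ e = inj₁ (trans e (cong suc ∂vk))
      ... | inj₂ e = inj₂ (ℕₚ.suc-injective (trans (sym e) ∂vk))

    inner-support : ∀ u v → lvl v ≡ 2 → ∀ k → T (inner u v k) → lvl u ≡ i × (∂ v u ≡ i ⊎ ∂ v u ≡ p)
    inner-support u v lv k t with above-elim m u k (∧-fst (above m u k) t) | covers-elim v k (∧-snd (above m u k) t)
    ... | lu′ , ∂ku | ∂vk , lvk = trans lu′ (cong (_+ m) lk) , along-edge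
      where
      lk : lvl k ≡ 1
      lk = ℕₚ.suc-injective (trans (sym lvk) lv)
      ∂uk : ∂ u k ≡ m
      ∂uk = trans (∂-sym u k) ∂ku
      along-edge : ∂ v u ≡ i ⊎ ∂ v u ≡ p
      along-edge with ∂-edge u k v (∂≡1⇒adj k v (trans (∂-sym k v) ∂vk) 1<n) (subst (_< n) (sym ∂uk) m<n)
      ... | inj₁ e = inj₁ (trans (∂-sym v u) (trans e (cong suc ∂uk)))
      ... | inj₂ e = inj₂ (trans (∂-sym v u) (ℕₚ.suc-injective (trans (sym e) ∂uk)))

    -- ∂(u,v) = i: the c_i neighbours of u in Γ_{i-1}(v) either cover u or lie in Γ_{i-1}(x).
    outer-split-cᵢ : ∀ u v → lvl v ≡ 2 → lvl u ≡ i → ∂ v u ≡ i →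
                     cc i ≡ count (outer u v) + count (λ w → atDist Γ m x w ∧ atDist Γ m v w ∧ adj u w)
    outer-split-cᵢ u v lv lu ∂vu =
      trans (sym (hc i v u ∂vu (s≤s z≤n)))
            (trans (count-split _ (λ z → lvl z ≡ᵇ suc (lvl u)))
                   (P.cong₂ _+_ (count-cong _ (outer u v) to-outer from-outer) (count-cong _ _ to-inside from-inside)))
      where
      to-outer : ∀ z → T ((atDist Γ m v z ∧ adj u z) ∧ (lvl z ≡ᵇ suc (lvl u))) → T (outer u v z)
      to-outer z t = ∧-intro (covers-intro z u (adj⇒∂≡1 z u (subst T (symmetric u z) uz)) lz)
                             (above-intro m z v (trans lz (trans (cong suc lu) (cong (_+ m) (sym lv)))) ∂vz)
        where
        vz-uz = ∧-fst (atDist Γ m v z ∧ adj u z) t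
        uz = ∧-snd (atDist Γ m v z) vz-uz
        ∂vz = ℕₚ.≡ᵇ⇒≡ (∂ v z) m (∧-fst (atDist Γ m v z) vz-uz)
        lz = ℕₚ.≡ᵇ⇒≡ (lvl z) _ (∧-snd (atDist Γ m v z ∧ adj u z) t)
      from-outer : ∀ z → T (outer u v z) → T ((atDist Γ m v z ∧ adj u z) ∧ (lvl z ≡ᵇ suc (lvl u)))
      from-outer z t with covers-elim z u (∧-fst (covers z u) t) | above-elim m z v (∧-snd (covers z u) t)
      ... | ∂zu , lz | _ , ∂vz = ∧-intro (∧-intro (ℕₚ.≡⇒≡ᵇ (∂ v z) m ∂vz) (∂≡1⇒adj u z (trans (∂-sym u z) ∂zu) 1<n))
                                        (ℕₚ.≡⇒≡ᵇ (lvl z) _ lz)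
      to-inside : ∀ z → T ((atDist Γ m v z ∧ adj u z) ∧ not (lvl z ≡ᵇ suc (lvl u))) →
                  T (atDist Γ m x z ∧ atDist Γ m v z ∧ adj u z)
      to-inside z t = ∧-intro (ℕₚ.≡⇒≡ᵇ (lvl z) m lz) vz-uz
        where
        vz-uz = ∧-fst (atDist Γ m v z ∧ adj u z) t
        uz = ∧-snd (atDist Γ m v z) vz-uz
        lz : lvl z ≡ m
        lz with ∂-edge x u z uz (subst (_< n) (sym lu) i<n)
        ... | inj₁ e = ⊥-elim (not-true (∧-snd (atDist Γ m v z ∧ adj u z) t) (ℕₚ.≡⇒≡ᵇ (lvl z) _ e))
        ... | inj₂ e = ℕₚ.suc-injective (trans (sym e) lu)
      from-inside : ∀ z → T (atDist Γ m x z ∧ atDist Γ m v z ∧ adj u z) →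
                    T ((atDist Γ m v z ∧ adj u z) ∧ not (lvl z ≡ᵇ suc (lvl u)))
      from-inside z t = ∧-intro (∧-snd (atDist Γ m x z) t) (not-intro (λ s → two-apart m
        (trans (sym (ℕₚ.≡ᵇ⇒≡ (lvl z) m (∧-fst (atDist Γ m x z) t)))
               (trans (ℕₚ.≡ᵇ⇒≡ (lvl z) _ s) (cong suc lu)))))

    inner-common : ∀ u v → lvl v ≡ 2 → lvl u ≡ i → count (inner u v) ≡ count (λ w → adj x w ∧ adj v w ∧ atDist Γ m u w)
    inner-common u v lv lu = count-cong (inner u v) _ to from
      where
      to : ∀ k → T (inner u v k) → T (adj x k ∧ adj v k ∧ atDist Γ m u k)
      to k t with above-elim m u k (∧-fst (above m u k) t) | covers-elim v k (∧-snd (above m u k) t)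
      ... | _ , ∂ku | ∂vk , lvk =
        ∧-intro (∂≡1⇒adj x k (ℕₚ.suc-injective (trans (sym lvk) lv)) 1<n)
                (∧-intro (∂≡1⇒adj v k ∂vk 1<n) (ℕₚ.≡⇒≡ᵇ (∂ u k) m (trans (∂-sym u k) ∂ku)))
      from : ∀ k → T (adj x k ∧ adj v k ∧ atDist Γ m u k) → T (inner u v k)
      from k t = ∧-intro (above-intro m u k (trans lu (cong (_+ m) (sym lk))) (trans (∂-sym k u) ∂uk))
                         (covers-intro v k (adj⇒∂≡1 v k vk) (trans lv (cong suc (sym lk))))
        where
        lk = adj⇒∂≡1 x k (∧-fst (adj x k) t)
        vk = ∧-fst (adj v k) (∧-snd (adj x k) t)
        ∂uk = ℕₚ.≡ᵇ⇒≡ (∂ u k) m (∧-snd (adj v k) (∧-snd (adj x k) t))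

    -- ∂(u,v) = i - 2: every neighbour of u one level further out covers u, so there are b_i of them.
    outer-bᵢ : ∀ u v → lvl v ≡ 2 → lvl u ≡ i → ∂ v u ≡ p → count (outer u v) ≡ bb i
    outer-bᵢ u v lv lu ∂vu = trans (count-cong (outer u v) (λ z → atDist Γ (suc i) x z ∧ adj u z) to from) (hb i x u lu)
      where
      to : ∀ z → T (outer u v z) → T (atDist Γ (suc i) x z ∧ adj u z)
      to z t with covers-elim z u (∧-fst (covers z u) t)
      ... | ∂zu , lz = ∧-intro (ℕₚ.≡⇒≡ᵇ (lvl z) _ (trans lz (cong suc lu)))
                               (∂≡1⇒adj u z (trans (∂-sym u z) ∂zu) 1<n)
      from : ∀ z → T (atDist Γ (suc i) x z ∧ adj u z) → T (outer u v z)
      from z t = ∧-intro (covers-intro z u (adj⇒∂≡1 z u (subst T (symmetric u z) uz)) (trans lz (cong suc (sym lu))))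
                         (above-intro m z v (trans lz (cong (_+ m) (sym lv))) ∂vz)
        where
        lz = ℕₚ.≡ᵇ⇒≡ (lvl z) _ (∧-fst (atDist Γ (suc i) x z) t)
        uz = ∧-snd (atDist Γ (suc i) x z) t
        ∂vz : ∂ v z ≡ m
        ∂vz = ≤-antisym (subst (λ d → ∂ v z ≤ suc d) ∂vu (∂-step v u z uz))
                        (ℕₚ.≤-pred (ℕₚ.≤-pred (subst₂ _≤_ lz (cong (_+ ∂ v z) lv) (lvl-≤ v z))))

    -- ∂(u,v) = i - 2: every neighbour of v one level closer to x lies i - 1 levels below u,
    -- so there are c_2 of them.
    inner-c₂ : ∀ u v → lvl v ≡ 2 → lvl u ≡ i → ∂ v u ≡ p → count (inner u v) ≡ cc 2
    inner-c₂ u v lv lu ∂vu = trans (count-cong (inner u v) (λ z → atDist Γ 1 x z ∧ adj v z) to from) (hc 2 x v lv (s≤s z≤n))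
      where
      to : ∀ k → T (inner u v k) → T (atDist Γ 1 x k ∧ adj v k)
      to k t with covers-elim v k (∧-snd (above m u k) t)
      ... | ∂vk , lvk = ∧-intro (ℕₚ.≡⇒≡ᵇ (lvl k) 1 (ℕₚ.suc-injective (trans (sym lvk) lv))) (∂≡1⇒adj v k ∂vk 1<n)
      from : ∀ k → T (atDist Γ 1 x k ∧ adj v k) → T (inner u v k)
      from k t = ∧-intro (above-intro m u k (trans lu (cong (_+ m) (sym lk))) ∂ku)
                         (covers-intro v k (adj⇒∂≡1 v k vk) (trans lv (cong suc (sym lk))))
        where
        lk = ℕₚ.≡ᵇ⇒≡ (lvl k) 1 (∧-fst (atDist Γ 1 x k) t)
        vk = ∧-snd (atDist Γ 1 x k) t
        ∂ku : ∂ k u ≡ m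
        ∂ku = ≤-antisym (subst₂ (λ a b → ∂ k u ≤ a + b) (adj⇒∂≡1 k v (subst T (symmetric v k) vk)) ∂vu (∂-triangle k v u))
                        (ℕₚ.≤-pred (subst₂ _≤_ lu (cong (_+ ∂ k u) lk) (lvl-≤ k u)))

module Levels {c ℓ} (ℛ : CommutativeRing c ℓ) {n : ℕ} (Γ : Graph n) (x : Fin n) (D : ℕ)
              (diameter : ∀ u v → dist Γ u v ≤ D) where
  open CommutativeRing ℛ
  open Mat ℛ n
  open MatrixFacts ℛ n
  open Metric Γ
  open Layers Γ x
  open import Relation.Binary.Reasoning.Setoid setoid
  open ℕₚ using (≤-trans; ≤-reflexive; <⇒≱)

  E* : ℕ → M
  E* = Estar Γ x

  -- E*_j is diagonal: multiplying by it keeps the rows (columns) of vertices at level j.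
  E*-left : ∀ j (Q : M) u v → (E* j ⊛ Q) u v ≈ bool (lvl u ≡ᵇ j) * Q u v
  E*-left j Q u v = trans (∑-single _ u off) diagonal
    where
    off : ∀ k → k ≢ u → E* j u k * Q k v ≈ 0#
    off k k≢u rewrite ⌊⌋-no (u ≟ k) (λ u≡k → k≢u (P.sym u≡k)) = zeroˡ _
    diagonal : E* j u u * Q u v ≈ bool (lvl u ≡ᵇ j) * Q u v
    diagonal with u ≟ u
    ... | yes _   = refl
    ... | no u≢u = ⊥-elim (u≢u P.refl)

  E*-right : ∀ j (Q : M) u v → (Q ⊛ E* j) u v ≈ Q u v * bool (lvl v ≡ᵇ j)
  E*-right j Q u v = trans (∑-single _ v off) diagonal
    where
    off : ∀ k → k ≢ v → Q u k * E* j k v ≈ 0#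
    off k k≢v rewrite ⌊⌋-no (k ≟ v) k≢v = zeroʳ _
    diagonal : Q u v * E* j v v ≈ Q u v * bool (lvl v ≡ᵇ j)
    diagonal with v ≟ v
    ... | yes _   = refl
    ... | no v≢v = ⊥-elim (v≢v P.refl)

  E*AE*-entry : ∀ i j u v → (E* i ⊛ (A Γ ⊛ E* j)) u v ≈
                bool (lvl u ≡ᵇ i) * (bool (atDist Γ 1 u v) * bool (lvl v ≡ᵇ j))
  E*AE*-entry i j u v = trans (E*-left i (A Γ ⊛ E* j) u v) (*-cong refl (E*-right j (A Γ) u v))

  E*AE*-vanish : ∀ i j u v → j ≢ lvl v → (E* i ⊛ (A Γ ⊛ E* j)) u v ≈ 0#
  E*AE*-vanish i j u v j≢ = trans (E*AE*-entry i j u v)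
    (trans (*-cong refl (trans (*-cong refl (≡ᵇ-no (λ e → j≢ (P.sym e)))) (zeroʳ _))) (zeroʳ _))

  R-entry : ∀ u v → Rmat Γ x D u v ≈ bool (covers u v)
  R-entry u v with ℕₚ.<-≤-connex (lvl v) D
  ... | inj₁ lvl<D = begin
    Rmat Γ x D u v
      ≈⟨ sumRange-single F u v (lvl v) 0 D (λ h → E*AE*-vanish (suc h) h u v) z≤n lvl<D ⟩
    F (lvl v) u v
      ≈⟨ E*AE*-entry (suc (lvl v)) (lvl v) u v ⟩
    bool (lvl u ≡ᵇ suc (lvl v)) * (bool (atDist Γ 1 u v) * bool (lvl v ≡ᵇ lvl v))
      ≈⟨ *-cong refl (trans (*-cong refl (≡ᵇ-yes {lvl v} P.refl)) (*-identityʳ _)) ⟩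
    bool (lvl u ≡ᵇ suc (lvl v)) * bool (atDist Γ 1 u v)
      ≈⟨ trans (*-comm _ _) (sym (bool-∧ (atDist Γ 1 u v) (lvl u ≡ᵇ suc (lvl v)))) ⟩
    bool (covers u v) ∎
    where
    F : ℕ → M
    F h = E* (suc h) ⊛ (A Γ ⊛ E* h)
  ... | inj₂ D≤lvl =
    trans (sumRange-vanish F u v 0 D (λ h _ h<D → E*AE*-vanish (suc h) h u v
                                         (λ h≡ → <⇒≱ h<D (≤-trans D≤lvl (≤-reflexive (P.sym h≡))))))
          (sym (bool-false beyond-diameter))
    where
    F : ℕ → M
    F h = E* (suc h) ⊛ (A Γ ⊛ E* h)
    beyond-diameter : ¬ T (covers u v)
    beyond-diameter t = <⇒≱ (s≤s D≤lvl)
      (P.subst (_≤ D) (ℕₚ.≡ᵇ⇒≡ (lvl u) _ (∧-snd (atDist Γ 1 u v) t)) (diameter x u))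

  L-entry : ∀ u v → Lmat Γ x D u v ≈ bool (covers v u)
  L-entry u v = by-level (lvl v) P.refl
    where
    F : ℕ → M
    F h = E* (h ∸ 1) ⊛ (A Γ ⊛ E* h)
    by-level : ∀ l → lvl v ≡ l → Lmat Γ x D u v ≈ bool (covers v u)
    by-level zero lv≡ =
      trans (sumRange-vanish F u v 1 D (λ h 1≤h _ → E*AE*-vanish (h ∸ 1) h u v
                                           (λ h≡ → <⇒≱ 1≤h (≤-reflexive (P.trans h≡ lv≡)))))
            (sym (bool-false level-zero))
      where
      level-zero : ¬ T (covers v u)
      level-zero t with P.trans (P.sym lv≡) (ℕₚ.≡ᵇ⇒≡ (lvl v) _ (∧-snd (atDist Γ 1 v u) t))
      ... | ()
    by-level (suc t) lv≡ = begin
      Lmat Γ x D u v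
        ≈⟨ sumRange-single F u v (suc t) 1 D (λ h h≢ → E*AE*-vanish (h ∸ 1) h u v (λ h≡ → h≢ (P.trans h≡ lv≡)))
                           (s≤s z≤n) (s≤s (P.subst (_≤ D) lv≡ (diameter x v))) ⟩
      F (suc t) u v
        ≈⟨ E*AE*-entry t (suc t) u v ⟩
      bool (lvl u ≡ᵇ t) * (bool (atDist Γ 1 u v) * bool (lvl v ≡ᵇ suc t))
        ≈⟨ *-cong refl (trans (*-cong refl (≡ᵇ-yes lv≡)) (*-identityʳ _)) ⟩
      bool (lvl u ≡ᵇ t) * bool (atDist Γ 1 u v)
        ≈⟨ *-comm _ _ ⟩
      bool (atDist Γ 1 u v) * bool (lvl u ≡ᵇ t)
        ≈⟨ *-cong (≡ᵇ-⇔ (P.trans (∂-sym v u)) (P.trans (∂-sym u v)))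
                  (≡ᵇ-⇔ (λ e → P.trans lv≡ (P.cong suc (P.sym e))) (λ e → ℕₚ.suc-injective (P.trans (P.sym e) lv≡))) ⟩
      bool (atDist Γ 1 v u) * bool (lvl v ≡ᵇ suc (lvl u))
        ≈⟨ sym (bool-∧ (atDist Γ 1 v u) (lvl v ≡ᵇ suc (lvl u))) ⟩
      bool (covers v u) ∎

  module Powers (1<n : 1 < n) (cc : ℕ → ℕ)
    (hc : ∀ j u w → dist Γ u w ≡ j → 1 ≤ j → count (λ z → atDist Γ (j ∸ 1) u z ∧ Graph.adj Γ w z) ≡ cc j) where
    open Descent 1<n cc hc

    R : M
    R = Rmat Γ x D

    R^-entry : ∀ m u v → (R ^ m) u v ≈ bool (above m u v) * fromℕ (prodC cc m)
    R^-entry zero u v with u ≟ v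
    ... | yes P.refl = sym (trans (*-cong (bool-true (above-intro 0 u u (P.sym (ℕₚ.+-identityʳ _)) (∂-self u)))
                                          (+-identityʳ 1#))
                                  (*-identityˡ 1#))
    ... | no u≢v = sym (trans (*-cong (bool-false (λ t → u≢v (P.sym (∂-zero v u (proj₂ (above-elim 0 u v t)))))) refl)
                              (zeroˡ _))
    R^-entry (suc m) u v = begin
      ∑ (λ k → R u k * (R ^ m) k v)
        ≈⟨ ∑-indicator _ (step m u v) Pₘ (λ k →
             trans (*-cong (R-entry u k) (R^-entry m k v))
                   (trans (sym (*-assoc _ _ _)) (*-cong (sym (bool-∧ (covers u k) (above m k v))) refl))) ⟩
      fromℕ (count (step m u v)) * Pₘ
        ≈⟨ counted (T? (above (suc m) u v)) ⟩
      bool (above (suc m) u v) * fromℕ (prodC cc (suc m)) ∎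
      where
      Pₘ : Carrier
      Pₘ = fromℕ (prodC cc m)
      counted : Dec (T (above (suc m) u v)) →
                fromℕ (count (step m u v)) * Pₘ ≈ bool (above (suc m) u v) * fromℕ (prodC cc (suc m))
      counted (yes t) = begin
        fromℕ (count (step m u v)) * Pₘ             ≈⟨ *-cong (reflexive (P.cong fromℕ (step-count m u v t))) refl ⟩
        fromℕ (cc (suc m)) * Pₘ                      ≈⟨ sym (fromℕ-* (cc (suc m)) (prodC cc m)) ⟩
        fromℕ (prodC cc (suc m))                     ≈⟨ sym (trans (*-cong (bool-true t) refl) (*-identityˡ _)) ⟩
        bool (above (suc m) u v) * fromℕ (prodC cc (suc m)) ∎
      counted (no ¬t) = begin
        fromℕ (count (step m u v)) * Pₘ
          ≈⟨ *-cong (reflexive (P.cong fromℕ (count-none (step m u v) (λ k s → ¬t (step-support m u v k s))))) refl ⟩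
        0# * Pₘ                                      ≈⟨ zeroˡ Pₘ ⟩
        0#                                           ≈⟨ sym (trans (*-cong (bool-false ¬t) refl) (zeroˡ _)) ⟩
        bool (above (suc m) u v) * fromℕ (prodC cc (suc m)) ∎

    e : Fin n → Carrier
    e v = bool (lvl v ≡ᵇ 2)

    L : M
    L = Lmat Γ x D

    LR^E*-entry : ∀ m u v → (L ⊛ ((R ^ m) ⊛ E* 2)) u v ≈
                  fromℕ (count (λ k → covers k u ∧ above m k v)) * (fromℕ (prodC cc m) * e v)
    LR^E*-entry m u v = ∑-indicator _ _ _ (λ k → begin
      L u k * ((R ^ m) ⊛ E* 2) k v
        ≈⟨ *-cong (L-entry u k) (trans (E*-right 2 (R ^ m) k v) (*-cong (R^-entry m k v) refl)) ⟩
      bool (covers k u) * ((bool (above m k v) * fromℕ (prodC cc m)) * e v)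
        ≈⟨ trans (*-cong refl (*-assoc _ _ _)) (sym (*-assoc _ _ _)) ⟩
      (bool (covers k u) * bool (above m k v)) * (fromℕ (prodC cc m) * e v)
        ≈⟨ *-cong (sym (bool-∧ (covers k u) (above m k v))) refl ⟩
      bool (covers k u ∧ above m k v) * (fromℕ (prodC cc m) * e v) ∎)

    R^LE*-entry : ∀ m u v → ((R ^ m) ⊛ (L ⊛ E* 2)) u v ≈
                  fromℕ (count (λ k → above m u k ∧ covers v k)) * (fromℕ (prodC cc m) * e v)
    R^LE*-entry m u v = ∑-indicator _ _ _ (λ k → begin
      (R ^ m) u k * (L ⊛ E* 2) k v
        ≈⟨ *-cong (R^-entry m u k) (trans (E*-right 2 L k v) (*-cong (L-entry k v) refl)) ⟩
      (bool (above m u k) * fromℕ (prodC cc m)) * (bool (covers v k) * e v)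
        ≈⟨ interchange _ _ _ _ ⟩
      (bool (above m u k) * bool (covers v k)) * (fromℕ (prodC cc m) * e v)
        ≈⟨ *-cong (sym (bool-∧ (above m u k) (covers v k))) refl ⟩
      bool (above m u k ∧ covers v k) * (fromℕ (prodC cc m) * e v) ∎)
      where open import Algebra.Properties.CommutativeSemigroup *-commutativeSemigroup using (interchange)

    E*AᵢE*-entry : ∀ i u v → (E* i ⊛ (Adist Γ i ⊛ E* 2)) u v ≈ bool (lvl u ≡ᵇ i) * (bool (atDist Γ i u v) * e v)
    E*AᵢE*-entry i u v = trans (E*-left i (Adist Γ i ⊛ E* 2) u v) (*-cong refl (E*-right 2 (Adist Γ i) u v))

    R^E*-entry : ∀ m u v → ((R ^ m) ⊛ E* 2) u v ≈ (bool (above m u v) * fromℕ (prodC cc m)) * e v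
    R^E*-entry m u v = trans (E*-right 2 (R ^ m) u v) (*-cong (R^-entry m u v) refl)

    module Lemma72 (side : Fin n → Bool)
      (bip : ∀ u v → T (Graph.adj Γ u v) → side u ≡ (if side v then false else true))
      (bb : ℕ → ℕ)
      (hb : ∀ j u w → dist Γ u w ≡ j → count (λ z → atDist Γ (suc j) u z ∧ Graph.adj Γ w z) ≡ bb j)
      (p : ℕ) (i<n : suc (suc p) < n) (α β : Carrier)
      (hyp : ∀ y z → dist Γ x y ≡ 2 → dist Γ x z ≡ suc (suc p) → dist Γ y z ≡ suc (suc p) →
             α + β * fromℕ (count (λ w → Graph.adj Γ x w ∧ Graph.adj Γ y w ∧ atDist Γ (suc p) z w))
             ≈ fromℕ (count (λ w → atDist Γ (suc p) x w ∧ atDist Γ (suc p) y w ∧ Graph.adj Γ z w))) where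
      open RingIdentities ℛ
      open Combination (fromℕ (prodC cc (suc p))) (fromℕ (prodC cc p)) (fromℕ (cc (suc (suc p))))
                       (fromℕ (cc (suc p))) (fromℕ (bb (suc (suc p)))) (fromℕ (cc 2)) α β
      open LevelTwo 1<n side bip cc bb hc hb p i<n

      I : Fin n → Carrier
      I u = bool (lvl u ≡ᵇ i)

      J : Fin n → Fin n → Carrier
      J u v = bool (atDist Γ i u v)

      I*J≈0 : ∀ u v → lvl u ≢ i ⊎ ∂ v u ≢ i → I u * J u v ≈ 0#
      I*J≈0 u v (inj₁ lu≢i) = trans (*-cong (≡ᵇ-no lu≢i) refl) (zeroˡ (J u v))
      I*J≈0 u v (inj₂ ∂≢i)  = trans (*-cong refl (≡ᵇ-no (λ e → ∂≢i (P.trans (∂-sym v u) e)))) (zeroʳ (I u))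

      count≈0 : ∀ (q : Fin n → Bool) → (∀ k → ¬ T (q k)) → fromℕ (count q) ≈ 0#
      count≈0 q none = reflexive (P.cong fromℕ (count-none q none))

      at-level-two : ∀ u v → lvl v ≡ 2 → fromℕ (count (outer u v)) * fromℕ (prodC cc m) ≈
                     combination (I u * J u v) (fromℕ (count (inner u v))) (bool (above p u v))
      at-level-two u v lv with lvl u ℕₚ.≟ i | ∂ v u ℕₚ.≟ i | ∂ v u ℕₚ.≟ p
      ... | no lu≢i | _ | _ =
        combination-vanish (count≈0 (outer u v) (λ k t → lu≢i (proj₁ (outer-support u v lv k t))))
                           (I*J≈0 u v (inj₁ lu≢i))
                           (count≈0 (inner u v) (λ k t → lu≢i (proj₁ (inner-support u v lv k t))))
                           (bool-false (λ t → lu≢i (P.trans (proj₁ (above-elim p u v t)) (P.cong (Nat._+ p) lv))))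
      ... | yes lu | yes ∂vu | _ =
        combination-first (trans (reflexive (P.cong fromℕ (outer-split-cᵢ u v lv lu ∂vu)))
                                 (fromℕ-+ (count (outer u v)) _))
                          (trans (+-cong refl (*-cong refl (reflexive (P.cong fromℕ (inner-common u v lv lu)))))
                                 (hyp v u lv lu ∂vu))
                          (trans (*-cong (≡ᵇ-yes lu) (≡ᵇ-yes (P.trans (∂-sym u v) ∂vu))) (*-identityˡ 1#))
                          (bool-false (λ t → two-apart p (P.trans (P.sym (proj₂ (above-elim p u v t))) ∂vu)))
      ... | yes lu | no ∂vu≢i | yes ∂vu =
        combination-rest (reflexive (P.cong fromℕ (outer-bᵢ u v lv lu ∂vu)))
                         (reflexive (P.cong fromℕ (inner-c₂ u v lv lu ∂vu)))
                         (fromℕ-* (cc m) (prodC cc p))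
                         (I*J≈0 u v (inj₂ ∂vu≢i))
                         (bool-true (above-intro p u v (P.trans lu (P.cong (Nat._+ p) (P.sym lv))) ∂vu))
      ... | yes lu | no ∂vu≢i | no ∂vu≢p =
        combination-vanish (count≈0 (outer u v) (λ k t → neither (proj₂ (outer-support u v lv k t))))
                           (I*J≈0 u v (inj₂ ∂vu≢i))
                           (count≈0 (inner u v) (λ k t → neither (proj₂ (inner-support u v lv k t))))
                           (bool-false (λ t → ∂vu≢p (proj₂ (above-elim p u v t))))
        where
        neither : ¬ (∂ v u ≡ i ⊎ ∂ v u ≡ p)
        neither (inj₁ e) = ∂vu≢i e
        neither (inj₂ e) = ∂vu≢p e

      -- Every entry is the identity above multiplied by e v, which vanishes unless ∂(x,v) = 2.
      entry-identity : ∀ u v →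
        (L ⊛ ((R ^ m) ⊛ E* 2)) u v ≈
        ((coef₁ · (E* i ⊛ (Adist Γ i ⊛ E* 2))) ⊕ ((⊖ (β · ((R ^ m) ⊛ (L ⊛ E* 2)))) ⊕ (coef₃ · ((R ^ p) ⊛ E* 2)))) u v
      entry-identity u v = begin
        (L ⊛ ((R ^ m) ⊛ E* 2)) u v
          ≈⟨ LR^E*-entry m u v ⟩
        fromℕ (count (outer u v)) * (fromℕ (prodC cc m) * e v)
          ≈⟨ by-level (lvl v ℕₚ.≟ 2) ⟩
        scaled (I u) (J u v) (fromℕ (count (inner u v))) (bool (above p u v)) (e v)
          ≈⟨ sym (+-cong (*-cong refl (E*AᵢE*-entry i u v))
                         (+-cong (-‿cong (*-cong refl (R^LE*-entry m u v))) (*-cong refl (R^E*-entry p u v)))) ⟩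
        ((coef₁ · (E* i ⊛ (Adist Γ i ⊛ E* 2))) ⊕ ((⊖ (β · ((R ^ m) ⊛ (L ⊛ E* 2)))) ⊕ (coef₃ · ((R ^ p) ⊛ E* 2)))) u v ∎
        where
        by-level : Dec (lvl v ≡ 2) → fromℕ (count (outer u v)) * (fromℕ (prodC cc m) * e v) ≈
                   scaled (I u) (J u v) (fromℕ (count (inner u v))) (bool (above p u v)) (e v)
        by-level (no lv≢2) = scaled-null _ (I u) (J u v) _ _ (≡ᵇ-no lv≢2)
        by-level (yes lv)  = combination-scale (e v) (at-level-two u v lv)

lemma7p2 : ∀ {c ℓ} (ℛ : CommutativeRing c ℓ) (n : ℕ) (Γ : Graph n)
  (D k : ℕ) (cc bb : ℕ → ℕ) (x : Fin n) (α β : ℕ → CommutativeRing.Carrier ℛ) →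
  IsDRG Γ D cc bb → Bipartite Γ → Regular Γ k → 4 ≤ D → 3 ≤ k →
  (∀ i → 2 ≤ i → i ≤ D ∸ 2 → ∀ y z →
    dist Γ x y ≡ 2 → dist Γ x z ≡ i → dist Γ y z ≡ i →
    CommutativeRing._≈_ ℛ
      (CommutativeRing._+_ ℛ (α i)
        (CommutativeRing._*_ ℛ (β i)
          (Mat.fromℕ ℛ n (count (λ w → Graph.adj Γ x w ∧ Graph.adj Γ y w ∧ atDist Γ (i ∸ 1) z w)))))
      (Mat.fromℕ ℛ n (count (λ w → atDist Γ (i ∸ 1) x w ∧ atDist Γ (i ∸ 1) y w ∧ Graph.adj Γ z w)))) →
  ∀ i → 2 ≤ i → i ≤ D ∸ 2 →
    let open CommutativeRing ℛ
        open Mat ℛ n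
        L = Lmat Γ x D
        R = Rmat Γ x D
        E = Estar Γ x
    in (L ⊛ ((R ^ (i ∸ 1)) ⊛ E 2))
       ≋ (((fromℕ (prodC cc (i ∸ 1)) * (fromℕ (cc i) - α i)) · (E i ⊛ (Adist Γ i ⊛ E 2)))
          ⊕ ((⊖ (β i · ((R ^ (i ∸ 1)) ⊛ (L ⊛ E 2))))
          ⊕ ((fromℕ (cc (i ∸ 1)) * (fromℕ (bb i) + β i * fromℕ (cc 2))) · ((R ^ (i ∸ 2)) ⊛ E 2))))
-- The diameter is attained, so D ≤ n and all levels involved are below n; the entrywise
-- identity then gives the theorem.
lemma7p2 ℛ n Γ D k cc bb x α β ((_ , diameter , u₀ , v₀ , ∂u₀v₀≡D) , hc , hb) (side , bip) _ 4≤D _ hyp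
         (suc (suc p)) 2≤i@(s≤s (s≤s z≤n)) i≤D∸2 = entry-identity
  where
  D≤n : D ≤ n
  D≤n = P.subst (_≤ n) ∂u₀v₀≡D (Metric.∂-bounded Γ u₀ v₀)
  i<n : suc (suc p) < n
  i<n = ℕₚ.<-≤-trans (ℕₚ.≤-<-trans i≤D∸2 (ℕₚ.∸-monoʳ-< (s≤s z≤n) (ℕₚ.≤-trans (s≤s (s≤s z≤n)) 4≤D))) D≤n
  1<n : 1 < n
  1<n = ℕₚ.≤-trans (s≤s (s≤s z≤n)) (ℕₚ.≤-trans 4≤D D≤n)
  open Levels ℛ Γ x D diameter
  open Powers 1<n cc hc
  open Lemma72 side bip bb hb p i<n (α (suc (suc p))) (β (suc (suc p))) (hyp (suc (suc p)) 2≤i i≤D∸2)
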